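{- Let $G$ be a graph of order $n \ge 1$. Then $\operatorname{avd}(G) \ge \frac{n 2^{n-1}}{2^n - 1}$, with equality if and only if $G \cong K_n$.
   Context: Graphs are finite and simple. A set $S \subseteq V(G)$ is a dominating set of $G$ if every vertex of $G$ is in $S$ or adjacent to a vertex of $S$. Let $\mathcal{D}(G)$ be the collection of dominating sets of $G$. The average order of dominating sets is $\operatorname{avd}(G) = \frac{1}{|\mathcal{D}(G)|}\sum_{S \in \mathcal{D}(G)} |S|$. $K_n$ is the complete graph on $n$ vertices. -}

module Defs where

open import Data.Bool using (Bool; true; false; not; _∧_)
open import Data.Nat using (ℕ; zero; suc; _+_; _*_; _∸_; _^_)
open import Data.Fin using (Fin; _≟_)
open import Data.Fin.Subset using (Subset; _∈_; ∣_∣)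
open import Data.Fin.Subset.Properties using (_∈?_)
open import Data.Fin.Properties using (all?; any?)
open import Data.Vec using (_∷_; [])
open import Data.List using (List; []; _∷_; map; _++_; filter; length)
open import Data.Nat.ListAction using (sum)
open import Data.Integer using (+_)
open import Data.Rational using (ℚ; _/_; 0ℚ)
open import Data.Product using (Σ; ∃; _×_; _,_)
open import Data.Sum using (_⊎_)
open import Relation.Binary.PropositionalEquality using (_≡_)
open import Relation.Nullary using (Dec; ¬_; yes; no)
open import Relation.Nullary.Decidable using (_⊎-dec_; _×-dec_; ⌊_⌋)
open import Function.Definitions using (Bijective)
open import Data.Bool.Properties using () renaming (_≟_ to _≟ᵇ_)

record Graph (n : ℕ) : Set where
  field
    adj   : Fin n → Fin n → Bool
    adj-sym    : ∀ u v → adj u v ≡ adj v u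
    adj-irrefl : ∀ v → adj v v ≡ false
open Graph public

Dominating : ∀ {n} → Graph n → Subset n → Set
Dominating G S = ∀ v → v ∈ S ⊎ ∃ λ u → u ∈ S × adj G u v ≡ true

dominating? : ∀ {n} (G : Graph n) (S : Subset n) → Dec (Dominating G S)
dominating? G S = all? λ v → (v ∈? S) ⊎-dec any? (λ u → (u ∈? S) ×-dec (adj G u v ≟ᵇ true))

allSubsets : ∀ n → List (Subset n)
allSubsets zero = [] ∷ []
allSubsets (suc n) = map (true ∷_) (allSubsets n) ++ map (false ∷_) (allSubsets n)

dominatingSets : ∀ {n} → Graph n → List (Subset n)
dominatingSets {n} G = filter (dominating? G) (allSubsets n)

-- a / b as a rational (with the convention a / 0 = 0, never used below
-- where it matters).
frac : ℕ → ℕ → ℚ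
frac a zero = 0ℚ
frac a (suc b) = (+ a) / suc b

avd : ∀ {n} → Graph n → ℚ
avd G = frac (sum (map ∣_∣ (dominatingSets G))) (length (dominatingSets G))

complete : ∀ n → Graph n
complete n = record
  { adj = λ u v → not ⌊ u ≟ v ⌋
  ; adj-sym = symK
  ; adj-irrefl = irrK }
  where
  open import Relation.Binary.PropositionalEquality using (refl; sym)
  symK : ∀ u v → not ⌊ u ≟ v ⌋ ≡ not ⌊ v ≟ u ⌋
  symK u v with u ≟ v | v ≟ u
  ... | yes _ | yes _ = refl
  ... | no _ | no _ = refl
  ... | yes p | no q = Data.Empty.⊥-elim (q (sym p)) where import Data.Empty
  ... | no p | yes q = Data.Empty.⊥-elim (p (sym q)) where import Data.Empty
  irrK : ∀ v → not ⌊ v ≟ v ⌋ ≡ false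
  irrK v with v ≟ v
  ... | yes _ = refl
  ... | no p = Data.Empty.⊥-elim (p refl) where import Data.Empty

_≅_ : ∀ {n} → Graph n → Graph n → Set
G ≅ H = Σ (Fin _ → Fin _) λ f → Bijective _≡_ _≡_ f × (∀ u v → adj G u v ≡ adj H (f u) (f v))

module Submission where

-- Let G have n = k + 1 vertices, let #𝒟 be its number of dominating sets and,
-- for a vertex v, let #𝒟∋ v and #𝒟∌ v count the dominating sets containing,
-- resp. avoiding, v.  Then
--   * #𝒟 = #𝒟∋ v + #𝒟∌ v, and double counting gives that the total order of
--     all dominating sets is  Σ_v #𝒟∋ v;
--   * S ↦ S ∪ {v} maps the dominating sets avoiding v injectively to those
--     containing v, and misses S ∪ {v} for S = V ∖ N[v]; so #𝒟∌ v < #𝒟∋ v;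
--   * #𝒟∋ v = #{S ∌ v : S ∪ {v} dominating} ≤ 2^k, with equality iff {v}
--     dominates, i.e. iff v is adjacent to every other vertex.
-- With m = 2^k and B = 2^n - 1 = 2m - 1, the bounds q < p ≤ m imply
-- m (p + q) ≤ p B, with equality only if p = m.  Summing over the vertices
-- gives n m #𝒟 ≤ (Σ_v #𝒟∋ v) B, i.e. avd G ≥ n m / B, and equality forces
-- every vertex to be universal.  Conversely, in K_n the dominating sets are
-- the 2^n - 1 nonempty sets and every #𝒟∋ v equals 2^k.

open import Defs
open import Data.Nat using (ℕ; _≥_; _*_; _∸_; _^_)
open import Data.Rational using (_≤_)
open import Data.Product using (_×_)
open import Relation.Binary.PropositionalEquality using (_≡_)
open import Function.Bundles using (_⇔_)

open import Data.Nat using (zero; suc; _+_; z≤n; s≤s; s≤s⁻¹)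
  renaming (_≤_ to _≤ₙ_; _<_ to _<ₙ_)
open import Data.Nat.Properties
open import Data.Nat.Tactic.RingSolver using (solve-∀)
open import Algebra.Properties.CommutativeSemigroup +-commutativeSemigroup using (interchange)
open import Data.Bool using (Bool; true; false; not; _∨_; if_then_else_)
open import Data.Bool.Properties using (∨-zeroʳ)
open import Data.Fin using (Fin) renaming (_≟_ to _≟ᶠ_; zero to fzero; suc to fsuc)
open import Data.Fin.Subset using (Subset; _∈_; _∉_; _⊆_; _∪_; ⁅_⁆; ⊥; ⊤; Nonempty; ∣_∣)
open import Data.Fin.Subset.Properties
  using (_∈?_; nonempty?; x∈⁅x⁆; x∈⁅y⁆⇒x≡y; ∉⊥; ∈⊤; x∈p∪q⁺; p⊆p∪q; ∪-identityˡ; ∪-identityʳ)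
open import Data.Vec using ([]; _∷_; tabulate; here; there)
open import Data.Vec.Properties using (lookup∘tabulate; []=⇒lookup; lookup⇒[]=)
open import Data.List using (List; []; _∷_; map; _++_; filter; length; allFin)
open import Data.List.Properties using (map-++; map-∘; length-tabulate; map-tabulate)
open import Data.List.Membership.Propositional using () renaming (_∈_ to _∈ₗ_)
open import Data.List.Membership.Propositional.Properties using (∈-allFin; ∈-map⁺; ∈-++⁺ˡ; ∈-++⁺ʳ)
open import Data.List.Relation.Unary.Any using (here; there)
open import Data.Nat.ListAction using (sum)
open import Data.Nat.ListAction.Properties using (sum-++)
open import Data.Product using (_,_)
open import Data.Sum using (inj₁; inj₂)
open import Function using (_∘_; id)
open import Function.Bundles using (mk⇔; Equivalence)
open import Function.Construct.Identity using (bijective)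
open import Relation.Nullary using (Dec; yes; no; ¬_; does; contradiction)
open import Relation.Nullary.Decidable using (¬?; dec-false; ⌊_⌋; isYes≗does)
open import Relation.Unary using (Pred; Decidable)
open import Relation.Binary.PropositionalEquality
  using (refl; sym; trans; cong; cong₂; subst; subst₂; _≢_; module ≡-Reasoning)
open import Data.Integer as ℤ using (+≤+)
open import Data.Integer.Properties using (pos-*; drop‿+≤+)
open import Data.Rational.Properties using (toℚᵘ-cancel-≤; toℚᵘ-mono-≤; toℚᵘ-fromℚᵘ)
  renaming (≤-reflexive to ≤ℚ-reflexive)
open import Data.Rational using (toℚᵘ)
open import Data.Rational.Unnormalised as ℚᵘ using (mkℚᵘ; *≤*)
open import Data.Rational.Unnormalised.Properties using (≤-respˡ-≃; ≤-respʳ-≃; ≃-sym)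

𝟙 : {P : Set} → Dec P → ℕ
𝟙 d = if does d then 1 else 0

𝟙-yes : {P : Set} (d : Dec P) → P → 𝟙 d ≡ 1
𝟙-yes (yes _) _ = refl
𝟙-yes (no ¬p) p = contradiction p ¬p

𝟙-no : {P : Set} (d : Dec P) → ¬ P → 𝟙 d ≡ 0
𝟙-no (yes p) ¬p = contradiction p ¬p
𝟙-no (no _) _ = refl

𝟙≡1⇒ : {P : Set} (d : Dec P) → 𝟙 d ≡ 1 → P
𝟙≡1⇒ (yes p) _ = p
𝟙≡1⇒ (no _) ()

𝟙≤1 : {P : Set} (d : Dec P) → 𝟙 d ≤ₙ 1
𝟙≤1 (yes _) = s≤s z≤n
𝟙≤1 (no _) = z≤n

𝟙-mono : {P Q : Set} (d : Dec P) (e : Dec Q) → (P → Q) → 𝟙 d ≤ₙ 𝟙 e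
𝟙-mono (yes p) e P⇒Q = ≤-reflexive (sym (𝟙-yes e (P⇒Q p)))
𝟙-mono (no _) e _ = z≤n

𝟙-cong : {P Q : Set} (d : Dec P) (e : Dec Q) → P ⇔ Q → 𝟙 d ≡ 𝟙 e
𝟙-cong d e P⇔Q = ≤-antisym (𝟙-mono d e (Equivalence.to P⇔Q)) (𝟙-mono e d (Equivalence.from P⇔Q))

𝟙-complement : {P : Set} (d : Dec P) → 𝟙 d + 𝟙 (¬? d) ≡ 1
𝟙-complement (yes _) = refl
𝟙-complement (no _) = refl

*𝟙≤ : {P : Set} (x : ℕ) (d : Dec P) → x * 𝟙 d ≤ₙ x
*𝟙≤ x d = ≤-trans (*-monoʳ-≤ x (𝟙≤1 d)) (≤-reflexive (*-identityʳ x))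

∑ : {A : Set} → List A → (A → ℕ) → ℕ
∑ xs f = sum (map f xs)

syntax ∑ xs (λ x → e) = ∑[ x ∈ xs ] e

module _ {A : Set} where

  ∑-cong : (xs : List A) {f g : A → ℕ} → (∀ x → f x ≡ g x) → ∑ xs f ≡ ∑ xs g
  ∑-cong [] _ = refl
  ∑-cong (x ∷ xs) f≡g = cong₂ _+_ (f≡g x) (∑-cong xs f≡g)

  ∑-mono : (xs : List A) {f g : A → ℕ} → (∀ x → f x ≤ₙ g x) → ∑ xs f ≤ₙ ∑ xs g
  ∑-mono [] _ = z≤n
  ∑-mono (x ∷ xs) f≤g = +-mono-≤ (f≤g x) (∑-mono xs f≤g)

  ∑-mono-< : (xs : List A) {f g : A → ℕ} {x : A} →
    (∀ y → f y ≤ₙ g y) → x ∈ₗ xs → f x <ₙ g x → ∑ xs f <ₙ ∑ xs g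
  ∑-mono-< (y ∷ ys) f≤g (here refl) fx<gx = +-mono-<-≤ fx<gx (∑-mono ys f≤g)
  ∑-mono-< (y ∷ ys) f≤g (there x∈ys) fx<gx = +-mono-≤-< (f≤g y) (∑-mono-< ys f≤g x∈ys fx<gx)

  ∑-equality : (xs : List A) {f g : A → ℕ} {x : A} →
    (∀ y → f y ≤ₙ g y) → ∑ xs f ≡ ∑ xs g → x ∈ₗ xs → f x ≡ g x
  ∑-equality xs {f} {g} {x} f≤g ∑f≡∑g x∈xs with m≤n⇒m<n∨m≡n (f≤g x)
  ... | inj₂ fx≡gx = fx≡gx
  ... | inj₁ fx<gx = contradiction ∑f≡∑g (<⇒≢ (∑-mono-< xs f≤g x∈xs fx<gx))

  ∑-distrib-+ : (xs : List A) (f g : A → ℕ) → ∑[ x ∈ xs ] (f x + g x) ≡ ∑ xs f + ∑ xs g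
  ∑-distrib-+ [] _ _ = refl
  ∑-distrib-+ (x ∷ xs) f g =
    trans (cong (f x + g x +_) (∑-distrib-+ xs f g)) (interchange (f x) (g x) (∑ xs f) (∑ xs g))

  ∑-distribʳ-* : (xs : List A) (f : A → ℕ) (c : ℕ) → ∑ xs f * c ≡ ∑[ x ∈ xs ] (f x * c)
  ∑-distribʳ-* [] _ _ = refl
  ∑-distribʳ-* (x ∷ xs) f c = trans (*-distribʳ-+ c (f x) (∑ xs f)) (cong (f x * c +_) (∑-distribʳ-* xs f c))

  ∑-const : (xs : List A) (c : ℕ) → ∑[ x ∈ xs ] c ≡ length xs * c
  ∑-const [] _ = refl
  ∑-const (x ∷ xs) c = cong (c +_) (∑-const xs c)

  ∑-zero : (xs : List A) → ∑[ x ∈ xs ] 0 ≡ 0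
  ∑-zero xs = trans (∑-const xs 0) (*-zeroʳ (length xs))

  ∑-++ : (xs ys : List A) (f : A → ℕ) → ∑ (xs ++ ys) f ≡ ∑ xs f + ∑ ys f
  ∑-++ xs ys f = trans (cong sum (map-++ f xs ys)) (sum-++ (map f xs) (map f ys))

  ∑-filter : {P : Pred A _} (P? : Decidable P) (xs : List A) (f : A → ℕ) →
    ∑ (filter P? xs) f ≡ ∑[ x ∈ xs ] (f x * 𝟙 (P? x))
  ∑-filter P? [] f = refl
  ∑-filter P? (x ∷ xs) f with does (P? x)
  ... | true = cong₂ _+_ (sym (*-identityʳ (f x))) (∑-filter P? xs f)
  ... | false = trans (∑-filter P? xs f) (cong (_+ ∑[ y ∈ xs ] (f y * 𝟙 (P? y))) (sym (*-zeroʳ (f x))))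

  length-filter : {P : Pred A _} (P? : Decidable P) (xs : List A) →
    length (filter P? xs) ≡ ∑[ x ∈ xs ] 𝟙 (P? x)
  length-filter P? [] = refl
  length-filter P? (x ∷ xs) with does (P? x)
  ... | true = cong suc (length-filter P? xs)
  ... | false = length-filter P? xs

∑-map : {A B : Set} (g : A → B) (xs : List A) (f : B → ℕ) → ∑ (map g xs) f ≡ ∑[ x ∈ xs ] f (g x)
∑-map g xs f = cong sum (sym (map-∘ xs))

∑-comm : {A B : Set} (xs : List A) (ys : List B) (h : A → B → ℕ) →
  ∑[ x ∈ xs ] ∑[ y ∈ ys ] h x y ≡ ∑[ y ∈ ys ] ∑[ x ∈ xs ] h x y
∑-comm [] ys h = sym (∑-zero ys)
∑-comm (x ∷ xs) ys h =
  trans (cong (∑ ys (h x) +_) (∑-comm xs ys h)) (sym (∑-distrib-+ ys (h x) (λ y → ∑[ x ∈ xs ] h x y)))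

∑-allFin-suc : ∀ {n} (f : Fin (suc n) → ℕ) → ∑ (allFin (suc n)) f ≡ f fzero + ∑[ v ∈ allFin n ] f (fsuc v)
∑-allFin-suc f =
  cong (λ xs → f fzero + sum xs) (trans (map-tabulate fsuc f) (sym (map-tabulate id (f ∘ fsuc))))

∑-allFin-const : ∀ n c → ∑[ v ∈ allFin n ] c ≡ n * c
∑-allFin-const n c = trans (∑-const (allFin n) c) (cong (_* c) (length-tabulate {n = n} id))

∣∣≡∑ : ∀ {n} (S : Subset n) → ∣ S ∣ ≡ ∑[ v ∈ allFin n ] 𝟙 (v ∈? S)
∣∣≡∑ [] = refl
∣∣≡∑ (true ∷ S) = trans (cong suc (∣∣≡∑ S)) (sym (∑-allFin-suc (λ v → 𝟙 (v ∈? true ∷ S))))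
∣∣≡∑ (false ∷ S) = trans (∣∣≡∑ S) (sym (∑-allFin-suc (λ v → 𝟙 (v ∈? false ∷ S))))

_∉?_ : ∀ {n} (v : Fin n) (S : Subset n) → Dec (v ∉ S)
v ∉? S = ¬? (v ∈? S)

∈-allSubsets : ∀ {n} (S : Subset n) → S ∈ₗ allSubsets n
∈-allSubsets [] = here refl
∈-allSubsets (true ∷ S) = ∈-++⁺ˡ (∈-map⁺ (true ∷_) (∈-allSubsets S))
∈-allSubsets {suc n} (false ∷ S) = ∈-++⁺ʳ (map (true ∷_) (allSubsets n)) (∈-map⁺ (false ∷_) (∈-allSubsets S))

∑-allSubsets-suc : ∀ {n} (f : Subset (suc n) → ℕ) →
  ∑ (allSubsets (suc n)) f ≡ ∑[ T ∈ allSubsets n ] f (true ∷ T) + ∑[ T ∈ allSubsets n ] f (false ∷ T)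
∑-allSubsets-suc {n} f =
  trans (∑-++ (map (true ∷_) (allSubsets n)) (map (false ∷_) (allSubsets n)) f)
        (cong₂ _+_ (∑-map (true ∷_) (allSubsets n) f) (∑-map (false ∷_) (allSubsets n) f))

count-subsets : ∀ n → ∑[ S ∈ allSubsets n ] 1 ≡ 2 ^ n
count-subsets zero = refl
count-subsets (suc n) =
  trans (∑-allSubsets-suc {n} (λ _ → 1)) (cong₂ _+_ (count-subsets n) (trans (count-subsets n) (sym (+-identityʳ _))))

count-∉ : ∀ {n} (v : Fin n) → ∑[ S ∈ allSubsets n ] 𝟙 (v ∉? S) ≡ 2 ^ (n ∸ 1)
count-∉ {suc n} fzero =
  trans (∑-allSubsets-suc {n} (λ S → 𝟙 (fzero ∉? S))) (cong₂ _+_ (∑-zero (allSubsets n)) (count-subsets n))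
count-∉ {suc (suc n)} (fsuc v) =
  trans (∑-allSubsets-suc {suc n} (λ S → 𝟙 (fsuc v ∉? S)))
        (cong₂ _+_ (count-∉ v) (trans (count-∉ v) (sym (+-identityʳ _))))

count-nonempty : ∀ n → suc (∑[ S ∈ allSubsets n ] 𝟙 (nonempty? S)) ≡ 2 ^ n
count-nonempty zero = cong suc (cong (_+ 0) (𝟙-no (nonempty? []) λ ()))
count-nonempty (suc n) = begin
    suc (∑[ S ∈ allSubsets (suc n) ] 𝟙 (nonempty? S))
  ≡⟨ cong suc (∑-allSubsets-suc {n} (λ S → 𝟙 (nonempty? S))) ⟩
    suc (∑[ T ∈ A ] 𝟙 (nonempty? (true ∷ T)) + ∑[ T ∈ A ] 𝟙 (nonempty? (false ∷ T)))
  ≡⟨ cong suc (cong₂ _+_ (∑-cong A with0) (∑-cong A without0)) ⟩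
    suc (∑[ T ∈ A ] 1 + ∑[ T ∈ A ] 𝟙 (nonempty? T))
  ≡⟨ sym (+-suc _ _) ⟩
    ∑[ T ∈ A ] 1 + suc (∑[ T ∈ A ] 𝟙 (nonempty? T))
  ≡⟨ cong₂ _+_ (count-subsets n) (trans (count-nonempty n) (sym (+-identityʳ _))) ⟩
    2 ^ suc n ∎
  where
  open ≡-Reasoning
  A = allSubsets n
  with0 : ∀ T → 𝟙 (nonempty? (true ∷ T)) ≡ 1
  with0 T = 𝟙-yes (nonempty? (true ∷ T)) (fzero , here)
  without0 : ∀ T → 𝟙 (nonempty? (false ∷ T)) ≡ 𝟙 (nonempty? T)
  without0 T = 𝟙-cong (nonempty? (false ∷ T)) (nonempty? T) (mk⇔ drop0 (λ { (v , v∈T) → fsuc v , there v∈T }))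
    where
    drop0 : Nonempty (false ∷ T) → Nonempty T
    drop0 (fsuc v , there v∈T) = v , v∈T

∑-insert : ∀ {n} (v : Fin n) (f : Subset n → ℕ) →
  ∑[ S ∈ allSubsets n ] (𝟙 (v ∈? S) * f S) ≡ ∑[ S ∈ allSubsets n ] (𝟙 (v ∉? S) * f (S ∪ ⁅ v ⁆))
∑-insert {suc n} fzero f = begin
    ∑[ S ∈ allSubsets (suc n) ] (𝟙 (fzero ∈? S) * f S)
  ≡⟨ ∑-allSubsets-suc {n} (λ S → 𝟙 (fzero ∈? S) * f S) ⟩
    ∑[ T ∈ A ] (1 * f (true ∷ T)) + ∑[ T ∈ A ] 0
  ≡⟨ +-comm _ (∑[ T ∈ A ] 0) ⟩
    ∑[ T ∈ A ] 0 + ∑[ T ∈ A ] (1 * f (true ∷ T))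
  ≡⟨ cong (∑[ T ∈ A ] 0 +_) (∑-cong A (λ T → cong (λ U → 1 * f (true ∷ U)) (sym (∪-identityʳ T)))) ⟩
    ∑[ T ∈ A ] 0 + ∑[ T ∈ A ] (1 * f (true ∷ (T ∪ ⊥)))
  ≡⟨ sym (∑-allSubsets-suc {n} (λ S → 𝟙 (fzero ∉? S) * f (S ∪ ⁅ fzero ⁆))) ⟩
    ∑[ S ∈ allSubsets (suc n) ] (𝟙 (fzero ∉? S) * f (S ∪ ⁅ fzero ⁆)) ∎
  where
  open ≡-Reasoning
  A = allSubsets n
∑-insert {suc n} (fsuc v) f = begin
    ∑[ S ∈ allSubsets (suc n) ] (𝟙 (fsuc v ∈? S) * f S)
  ≡⟨ ∑-allSubsets-suc {n} (λ S → 𝟙 (fsuc v ∈? S) * f S) ⟩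
    ∑[ T ∈ A ] (𝟙 (v ∈? T) * f (true ∷ T)) + ∑[ T ∈ A ] (𝟙 (v ∈? T) * f (false ∷ T))
  ≡⟨ cong₂ _+_ (∑-insert v (λ T → f (true ∷ T))) (∑-insert v (λ T → f (false ∷ T))) ⟩
    ∑[ T ∈ A ] (𝟙 (v ∉? T) * f (true ∷ (T ∪ ⁅ v ⁆))) + ∑[ T ∈ A ] (𝟙 (v ∉? T) * f (false ∷ (T ∪ ⁅ v ⁆)))
  ≡⟨ sym (∑-allSubsets-suc {n} (λ S → 𝟙 (fsuc v ∉? S) * f (S ∪ ⁅ fsuc v ⁆))) ⟩
    ∑[ S ∈ allSubsets (suc n) ] (𝟙 (fsuc v ∉? S) * f (S ∪ ⁅ fsuc v ⁆)) ∎
  where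
  open ≡-Reasoning
  A = allSubsets n

-- The per-vertex inequality: if B + 1 = 2m and q < p then
-- m (p + q) + m ≤ p B + p.  Hence m (p + q) ≤ p B when p ≤ m, and equality
-- m (p + q) = p B forces p ≥ m.
vertex-key : ∀ {m B p q} → suc B ≡ 2 * m → q <ₙ p → m * (p + q) + m ≤ₙ p * B + p
vertex-key {m} {B} {p} {q} B+1≡2m q<p = begin
  m * (p + q) + m  ≡⟨ shift m p q ⟩
  m * (p + suc q)  ≤⟨ *-monoʳ-≤ m (+-monoʳ-≤ p q<p) ⟩
  m * (p + p)      ≡⟨ double m p ⟩
  p * (2 * m)      ≡⟨ cong (p *_) (sym B+1≡2m) ⟩
  p * suc B        ≡⟨ trans (*-suc p B) (+-comm p (p * B)) ⟩
  p * B + p        ∎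
  where
  open ≤-Reasoning
  shift : ∀ m p q → m * (p + q) + m ≡ m * (p + suc q)
  shift = solve-∀
  double : ∀ m p → m * (p + p) ≡ p * (2 * m)
  double = solve-∀

vertex-bound : ∀ {m B p q} → suc B ≡ 2 * m → q <ₙ p → p ≤ₙ m → m * (p + q) ≤ₙ p * B
vertex-bound {m} {B} {p} {q} B+1≡2m q<p p≤m = +-cancelʳ-≤ p (m * (p + q)) (p * B)
  (≤-trans (+-monoʳ-≤ (m * (p + q)) p≤m) (vertex-key {m} {B} {p} {q} B+1≡2m q<p))

vertex-tight : ∀ {m B p q} → suc B ≡ 2 * m → q <ₙ p → m * (p + q) ≡ p * B → m ≤ₙ p
vertex-tight {m} {B} {p} {q} B+1≡2m q<p tight = +-cancelˡ-≤ (m * (p + q)) m p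
  (≤-trans (vertex-key {m} {B} {p} {q} B+1≡2m q<p) (≤-reflexive (cong (_+ p) (sym tight))))

toℚᵘ-frac : ∀ a b → toℚᵘ (frac a (suc b)) ℚᵘ.≃ mkℚᵘ (ℤ.+ a) b
toℚᵘ-frac a b = toℚᵘ-fromℚᵘ (mkℚᵘ (ℤ.+ a) b)

mkℚᵘ-≤⇔ : ∀ a b c d → (mkℚᵘ (ℤ.+ a) b ℚᵘ.≤ mkℚᵘ (ℤ.+ c) d) ⇔ (a * suc d ≤ₙ c * suc b)
mkℚᵘ-≤⇔ a b c d = mk⇔
  (λ { (*≤* le) → drop‿+≤+ (subst₂ ℤ._≤_ (sym (pos-* a (suc d))) (sym (pos-* c (suc b))) le) })
  (λ le → *≤* (subst₂ ℤ._≤_ (pos-* a (suc d)) (pos-* c (suc b)) (+≤+ le)))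

frac-≤⇔ : ∀ a b c d → 0 <ₙ b → 0 <ₙ d → (frac a b ≤ frac c d) ⇔ (a * d ≤ₙ c * b)
frac-≤⇔ a (suc b) c (suc d) _ _ = mk⇔
  (λ le → Equivalence.to (mkℚᵘ-≤⇔ a b c d)
            (≤-respˡ-≃ (toℚᵘ-frac a b) (≤-respʳ-≃ (toℚᵘ-frac c d) (toℚᵘ-mono-≤ le))))
  (λ le → toℚᵘ-cancel-≤ (≤-respˡ-≃ (≃-sym (toℚᵘ-frac a b)) (≤-respʳ-≃ (≃-sym (toℚᵘ-frac c d))
            (Equivalence.from (mkℚᵘ-≤⇔ a b c d) le))))

∈-tabulate⁺ : ∀ {n} (f : Fin n → Bool) {x : Fin n} → f x ≡ true → x ∈ tabulate f
∈-tabulate⁺ f {x} fx = lookup⇒[]= x (tabulate f) (trans (lookup∘tabulate f x) fx)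

∈-tabulate⁻ : ∀ {n} (f : Fin n → Bool) {x : Fin n} → x ∈ tabulate f → f x ≡ true
∈-tabulate⁻ f {x} x∈ = trans (sym (lookup∘tabulate f x)) ([]=⇒lookup x∈)

Universal : ∀ {n} → Graph n → Fin n → Set
Universal G v = ∀ u → u ≢ v → adj G v u ≡ true

IsComplete : ∀ {n} → Graph n → Set
IsComplete G = ∀ v → Universal G v

module _ {n : ℕ} (G : Graph n) where

  dominating-⊆ : ∀ {S T} → S ⊆ T → Dominating G S → Dominating G T
  dominating-⊆ S⊆T dom v with dom v
  ... | inj₁ v∈S = inj₁ (S⊆T v∈S)
  ... | inj₂ (u , u∈S , uv) = inj₂ (u , S⊆T u∈S , uv)

  universal-dominates : ∀ {v S} → Universal G v → v ∈ S → Dominating G S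
  universal-dominates {v} univ v∈S u with u ≟ᶠ v
  ... | yes refl = inj₁ v∈S
  ... | no u≢v = inj₂ (v , v∈S , univ u u≢v)

  singleton-dominating⇒universal : ∀ {v} → Dominating G ⁅ v ⁆ → Universal G v
  singleton-dominating⇒universal {v} dom u u≢v with dom u
  ... | inj₁ u∈⁅v⁆ = contradiction (x∈⁅y⁆⇒x≡y v u∈⁅v⁆) u≢v
  ... | inj₂ (w , w∈⁅v⁆ , wu) with x∈⁅y⁆⇒x≡y v w∈⁅v⁆
  ...   | refl = wu

  far : Fin n → Subset n
  far v = tabulate (λ u → not (does (u ≟ᶠ v) ∨ adj G v u))

  v∉far : ∀ v → v ∉ far v
  v∉far v v∈far with v ≟ᶠ v | ∈-tabulate⁻ _ v∈far
  ... | yes _ | ()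
  ... | no v≢v | _ = v≢v refl

  far-nonadjacent : ∀ {v u} → u ∈ far v → adj G v u ≢ true
  far-nonadjacent {v} {u} u∈far vu = contradiction true≡false λ ()
    where
    true≡false : true ≡ false
    true≡false = begin
      true                             ≡⟨ sym (∈-tabulate⁻ _ u∈far) ⟩
      not (does (u ≟ᶠ v) ∨ adj G v u)  ≡⟨ cong (λ b → not (does (u ≟ᶠ v) ∨ b)) vu ⟩
      not (does (u ≟ᶠ v) ∨ true)       ≡⟨ cong not (∨-zeroʳ (does (u ≟ᶠ v))) ⟩
      false                            ∎
      where open ≡-Reasoning

  far-not-dominating : ∀ v → ¬ Dominating G (far v)
  far-not-dominating v dom with dom v
  ... | inj₁ v∈far = v∉far v v∈far
  ... | inj₂ (u , u∈far , uv) = far-nonadjacent u∈far (trans (adj-sym G v u) uv)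

  far∪v-dominating : ∀ v → Dominating G (far v ∪ ⁅ v ⁆)
  far∪v-dominating v u with u ≟ᶠ v | adj G v u in vu
  ... | yes refl | _ = inj₁ (x∈p∪q⁺ (inj₂ (x∈⁅x⁆ u)))
  ... | no _ | true = inj₂ (v , x∈p∪q⁺ (inj₂ (x∈⁅x⁆ v)) , vu)
  ... | no u≢v | false = inj₁ (x∈p∪q⁺ (inj₁ (∈-tabulate⁺ _ u-far)))
    where
    u-far : not (does (u ≟ᶠ v) ∨ adj G v u) ≡ true
    u-far = cong₂ (λ a b → not (a ∨ b)) (dec-false (u ≟ᶠ v) u≢v) vu

  𝟙dom : Subset n → ℕ
  𝟙dom S = 𝟙 (dominating? G S)

  #𝒟 : ℕ
  #𝒟 = ∑[ S ∈ allSubsets n ] 𝟙dom S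

  #𝒟∋ #𝒟∌ : Fin n → ℕ
  #𝒟∋ v = ∑[ S ∈ allSubsets n ] (𝟙 (v ∈? S) * 𝟙dom S)
  #𝒟∌ v = ∑[ S ∈ allSubsets n ] (𝟙 (v ∉? S) * 𝟙dom S)

  -- The whole vertex set dominates, so there is at least one dominating set.
  #𝒟-positive : 0 <ₙ #𝒟
  #𝒟-positive = subst (_<ₙ #𝒟) (∑-zero (allSubsets n))
    (∑-mono-< (allSubsets n) (λ _ → z≤n) (∈-allSubsets ⊤) (≤-reflexive (sym ⊤-dominating)))
    where
    ⊤-dominating : 𝟙dom ⊤ ≡ 1
    ⊤-dominating = 𝟙-yes (dominating? G ⊤) (λ _ → inj₁ ∈⊤)

  #𝒟≡∋+∌ : ∀ v → #𝒟 ≡ #𝒟∋ v + #𝒟∌ v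
  #𝒟≡∋+∌ v = trans (∑-cong (allSubsets n) split) (∑-distrib-+ (allSubsets n) _ _)
    where
    split : ∀ S → 𝟙dom S ≡ 𝟙 (v ∈? S) * 𝟙dom S + 𝟙 (v ∉? S) * 𝟙dom S
    split S = begin
      𝟙dom S                                     ≡⟨ sym (*-identityˡ (𝟙dom S)) ⟩
      1 * 𝟙dom S                                 ≡⟨ cong (_* 𝟙dom S) (sym (𝟙-complement (v ∈? S))) ⟩
      (𝟙 (v ∈? S) + 𝟙 (v ∉? S)) * 𝟙dom S        ≡⟨ *-distribʳ-+ (𝟙dom S) (𝟙 (v ∈? S)) (𝟙 (v ∉? S)) ⟩
      𝟙 (v ∈? S) * 𝟙dom S + 𝟙 (v ∉? S) * 𝟙dom S ∎
      where open ≡-Reasoning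

  -- Double counting pairs (v, S) with v ∈ S ∈ 𝒟(G).
  total-order : ∑ (dominatingSets G) ∣_∣ ≡ ∑[ v ∈ allFin n ] #𝒟∋ v
  total-order = begin
    ∑ (filter (dominating? G) (allSubsets n)) ∣_∣
      ≡⟨ ∑-filter (dominating? G) (allSubsets n) ∣_∣ ⟩
    ∑[ S ∈ allSubsets n ] (∣ S ∣ * 𝟙dom S)
      ≡⟨ ∑-cong (allSubsets n) (λ S → trans (cong (_* 𝟙dom S) (∣∣≡∑ S))
                                            (∑-distribʳ-* (allFin n) (λ v → 𝟙 (v ∈? S)) (𝟙dom S))) ⟩
    ∑[ S ∈ allSubsets n ] ∑[ v ∈ allFin n ] (𝟙 (v ∈? S) * 𝟙dom S)
      ≡⟨ ∑-comm (allSubsets n) (allFin n) (λ S v → 𝟙 (v ∈? S) * 𝟙dom S) ⟩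
    ∑[ v ∈ allFin n ] #𝒟∋ v ∎
    where open ≡-Reasoning

  avd≡ : avd G ≡ frac (∑[ v ∈ allFin n ] #𝒟∋ v) #𝒟
  avd≡ = cong₂ frac total-order (length-filter (dominating? G) (allSubsets n))

  frac≤avd⇔ : ∀ {a b} → 0 <ₙ b → (frac a b ≤ avd G) ⇔ (a * #𝒟 ≤ₙ (∑[ v ∈ allFin n ] #𝒟∋ v) * b)
  frac≤avd⇔ {a} {b} b>0 rewrite avd≡ =
    frac-≤⇔ a b (∑[ v ∈ allFin n ] #𝒟∋ v) #𝒟 b>0 #𝒟-positive

  avd≤frac⇔ : ∀ {a b} → 0 <ₙ b → (avd G ≤ frac a b) ⇔ ((∑[ v ∈ allFin n ] #𝒟∋ v) * b ≤ₙ a * #𝒟)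
  avd≤frac⇔ {a} {b} b>0 rewrite avd≡ =
    frac-≤⇔ (∑[ v ∈ allFin n ] #𝒟∋ v) #𝒟 a b #𝒟-positive b>0

  avoid≤insert : ∀ v S → 𝟙 (v ∉? S) * 𝟙dom S ≤ₙ 𝟙 (v ∉? S) * 𝟙dom (S ∪ ⁅ v ⁆)
  avoid≤insert v S = *-monoʳ-≤ (𝟙 (v ∉? S))
    (𝟙-mono (dominating? G S) (dominating? G (S ∪ ⁅ v ⁆)) (dominating-⊆ (p⊆p∪q ⁅ v ⁆)))

  -- The injection S ↦ S ∪ {v} misses far v ∪ {v}, so strictly more dominating
  -- sets contain v than avoid it.
  #𝒟∌<#𝒟∋ : ∀ v → #𝒟∌ v <ₙ #𝒟∋ v
  #𝒟∌<#𝒟∋ v = subst (#𝒟∌ v <ₙ_) (sym (∑-insert v 𝟙dom))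
    (∑-mono-< (allSubsets n) (avoid≤insert v) (∈-allSubsets (far v)) missed)
    where
    missed : 𝟙 (v ∉? far v) * 𝟙dom (far v) <ₙ 𝟙 (v ∉? far v) * 𝟙dom (far v ∪ ⁅ v ⁆)
    missed = subst₂ _<ₙ_
      (sym (trans (cong (𝟙 (v ∉? far v) *_) (𝟙-no (dominating? G (far v)) (far-not-dominating v)))
                  (*-zeroʳ (𝟙 (v ∉? far v)))))
      (sym (cong₂ _*_ (𝟙-yes (v ∉? far v) (v∉far v)) (𝟙-yes (dominating? G _) (far∪v-dominating v))))
      (s≤s z≤n)

  inserted≤avoiding : ∀ v S → 𝟙 (v ∉? S) * 𝟙dom (S ∪ ⁅ v ⁆) ≤ₙ 𝟙 (v ∉? S)
  inserted≤avoiding v S = *𝟙≤ (𝟙 (v ∉? S)) (dominating? G (S ∪ ⁅ v ⁆))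

  #𝒟∋≤half : ∀ v → #𝒟∋ v ≤ₙ 2 ^ (n ∸ 1)
  #𝒟∋≤half v = begin
    #𝒟∋ v                                                   ≡⟨ ∑-insert v 𝟙dom ⟩
    ∑[ S ∈ allSubsets n ] (𝟙 (v ∉? S) * 𝟙dom (S ∪ ⁅ v ⁆))  ≤⟨ ∑-mono (allSubsets n) (inserted≤avoiding v) ⟩
    ∑[ S ∈ allSubsets n ] 𝟙 (v ∉? S)                        ≡⟨ count-∉ v ⟩
    2 ^ (n ∸ 1)                                              ∎
    where open ≤-Reasoning

  -- ... and if exactly 2^(n-1) do, then already {v} = ∅ ∪ {v} dominates, so
  -- v is universal.
  #𝒟∋≡half⇒universal : ∀ v → #𝒟∋ v ≡ 2 ^ (n ∸ 1) → Universal G v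
  #𝒟∋≡half⇒universal v eq =
    singleton-dominating⇒universal
      (subst (Dominating G) (∪-identityˡ ⁅ v ⁆) (𝟙≡1⇒ (dominating? G (⊥ ∪ ⁅ v ⁆)) ⊥∪v-dominating))
    where
    at⊥ : 𝟙 (v ∉? ⊥) * 𝟙dom (⊥ ∪ ⁅ v ⁆) ≡ 𝟙 (v ∉? ⊥)
    at⊥ = ∑-equality (allSubsets n) (inserted≤avoiding v)
            (trans (sym (∑-insert v 𝟙dom)) (trans eq (sym (count-∉ v)))) (∈-allSubsets ⊥)
    ⊥∪v-dominating : 𝟙dom (⊥ ∪ ⁅ v ⁆) ≡ 1
    ⊥∪v-dominating = trans (sym (*-identityˡ _))
      (subst (λ c → c * 𝟙dom (⊥ ∪ ⁅ v ⁆) ≡ c) (𝟙-yes (v ∉? ⊥) ∉⊥) at⊥)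

  -- Conversely, for universal v every S ∪ {v} dominates, so the bound is attained.
  universal⇒#𝒟∋≡half : ∀ v → Universal G v → #𝒟∋ v ≡ 2 ^ (n ∸ 1)
  universal⇒#𝒟∋≡half v univ = trans (∑-insert v 𝟙dom) (trans (∑-cong (allSubsets n) always) (count-∉ v))
    where
    always : ∀ S → 𝟙 (v ∉? S) * 𝟙dom (S ∪ ⁅ v ⁆) ≡ 𝟙 (v ∉? S)
    always S = trans (cong (𝟙 (v ∉? S) *_) (𝟙-yes (dominating? G (S ∪ ⁅ v ⁆)) S∪v-dominating)) (*-identityʳ _)
      where
      S∪v-dominating : Dominating G (S ∪ ⁅ v ⁆)
      S∪v-dominating = universal-dominates univ (x∈p∪q⁺ (inj₂ (x∈⁅x⁆ v)))

  nm#𝒟≡∑ : ∀ m → n * m * #𝒟 ≡ ∑[ v ∈ allFin n ] (m * (#𝒟∋ v + #𝒟∌ v))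
  nm#𝒟≡∑ m = begin
    n * m * #𝒟                                  ≡⟨ *-assoc n m #𝒟 ⟩
    n * (m * #𝒟)                                ≡⟨ sym (∑-allFin-const n (m * #𝒟)) ⟩
    ∑[ v ∈ allFin n ] (m * #𝒟)                  ≡⟨ ∑-cong (allFin n) (λ v → cong (m *_) (#𝒟≡∋+∌ v)) ⟩
    ∑[ v ∈ allFin n ] (m * (#𝒟∋ v + #𝒟∌ v))    ∎
    where open ≡-Reasoning

  summed-bound : ∀ {m B} → suc B ≡ 2 * m → (∀ v → #𝒟∋ v ≤ₙ m) →
    n * m * #𝒟 ≤ₙ (∑[ v ∈ allFin n ] #𝒟∋ v) * B
  summed-bound {m} {B} B+1≡2m #𝒟∋≤m = begin
    n * m * #𝒟                                ≡⟨ nm#𝒟≡∑ m ⟩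
    ∑[ v ∈ allFin n ] (m * (#𝒟∋ v + #𝒟∌ v))  ≤⟨ ∑-mono (allFin n) (λ v → vertex-bound B+1≡2m (#𝒟∌<#𝒟∋ v) (#𝒟∋≤m v)) ⟩
    ∑[ v ∈ allFin n ] (#𝒟∋ v * B)             ≡⟨ sym (∑-distribʳ-* (allFin n) #𝒟∋ B) ⟩
    (∑[ v ∈ allFin n ] #𝒟∋ v) * B             ∎
    where open ≤-Reasoning

  summed-tight : ∀ {m B} → suc B ≡ 2 * m → (∀ v → #𝒟∋ v ≤ₙ m) →
    n * m * #𝒟 ≡ (∑[ v ∈ allFin n ] #𝒟∋ v) * B → ∀ v → #𝒟∋ v ≡ m
  summed-tight {m} {B} B+1≡2m #𝒟∋≤m tight v =
    ≤-antisym (#𝒟∋≤m v) (vertex-tight B+1≡2m (#𝒟∌<#𝒟∋ v) at-v)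
    where
    at-v : m * (#𝒟∋ v + #𝒟∌ v) ≡ #𝒟∋ v * B
    at-v = ∑-equality (allFin n) (λ u → vertex-bound B+1≡2m (#𝒟∌<#𝒟∋ u) (#𝒟∋≤m u))
             (trans (sym (nm#𝒟≡∑ m)) (trans tight (∑-distribʳ-* (allFin n) #𝒟∋ B))) (∈-allFin v)

≅K⇒complete : ∀ {n} (G : Graph n) → G ≅ complete n → IsComplete G
≅K⇒complete G (f , (f-injective , _) , f-preserves) v u u≢v =
  trans (f-preserves v u) (cong not (trans (isYes≗does (f v ≟ᶠ f u)) (dec-false (f v ≟ᶠ f u) fv≢fu)))
  where
  fv≢fu : f v ≢ f u
  fv≢fu fv≡fu = u≢v (sym (f-injective fv≡fu))

complete⇒≅K : ∀ {n} (G : Graph n) → IsComplete G → G ≅ complete n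
complete⇒≅K G isComplete = id , bijective _≡_ , preserves
  where
  preserves : ∀ u v → adj G u v ≡ not ⌊ u ≟ᶠ v ⌋
  preserves u v with u ≟ᶠ v
  ... | yes refl = adj-irrefl G u
  ... | no u≢v = isComplete u v (λ v≡u → u≢v (sym v≡u))

complete-dominating⇔nonempty : ∀ {k} (G : Graph (suc k)) → IsComplete G → ∀ S → Dominating G S ⇔ Nonempty S
complete-dominating⇔nonempty G isComplete S =
  mk⇔ nonempty (λ { (v , v∈S) → universal-dominates G (isComplete v) v∈S })
  where
  nonempty : Dominating G S → Nonempty S
  nonempty dom with dom fzero
  ... | inj₁ 0∈S = fzero , 0∈S
  ... | inj₂ (u , u∈S , _) = u , u∈S

#𝒟-complete : ∀ {k} (G : Graph (suc k)) → IsComplete G → suc (#𝒟 G) ≡ 2 ^ suc k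
#𝒟-complete {k} G isComplete = trans
  (cong suc (∑-cong (allSubsets (suc k))
    (λ S → 𝟙-cong (dominating? G S) (nonempty? S) (complete-dominating⇔nonempty G isComplete S))))
  (count-nonempty (suc k))

2^[1+k]∸1+1 : ∀ k → suc (2 ^ suc k ∸ 1) ≡ 2 * 2 ^ k
2^[1+k]∸1+1 k = m+[n∸m]≡n (m^n>0 2 (suc k))

2^[1+k]∸1>0 : ∀ k → 0 <ₙ 2 ^ suc k ∸ 1
2^[1+k]∸1>0 k = s≤s⁻¹ (subst (2 ≤ₙ_) (sym (2^[1+k]∸1+1 k)) (*-monoʳ-≤ 2 (m^n>0 2 k)))

theorem2p5 : (n : ℕ) → n ≥ 1 → (G : Graph n) →
    (frac (n * 2 ^ (n ∸ 1)) (2 ^ n ∸ 1) ≤ avd G) × ((avd G ≡ frac (n * 2 ^ (n ∸ 1)) (2 ^ n ∸ 1)) ⇔ (G ≅ complete n))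
theorem2p5 n@(suc k) _ G = lower-bound , mk⇔ tight⇒K K⇒tight
  where
  B+1≡2m : suc (2 ^ n ∸ 1) ≡ 2 * 2 ^ k
  B+1≡2m = 2^[1+k]∸1+1 k

  lower-bound : frac (n * 2 ^ k) (2 ^ n ∸ 1) ≤ avd G
  lower-bound = Equivalence.from (frac≤avd⇔ G (2^[1+k]∸1>0 k)) (summed-bound G B+1≡2m (#𝒟∋≤half G))

  tight⇒K : avd G ≡ frac (n * 2 ^ k) (2 ^ n ∸ 1) → G ≅ complete n
  tight⇒K tight = complete⇒≅K G λ v → #𝒟∋≡half⇒universal G v (summed-tight G B+1≡2m (#𝒟∋≤half G) equal v)
    where
    equal : n * 2 ^ k * #𝒟 G ≡ (∑[ v ∈ allFin n ] #𝒟∋ G v) * (2 ^ n ∸ 1)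
    equal = ≤-antisym (summed-bound G B+1≡2m (#𝒟∋≤half G))
                      (Equivalence.to (avd≤frac⇔ G (2^[1+k]∸1>0 k)) (≤ℚ-reflexive tight))

  K⇒tight : G ≅ complete n → avd G ≡ frac (n * 2 ^ k) (2 ^ n ∸ 1)
  K⇒tight G≅K = trans (avd≡ G) (cong₂ frac total≡ #𝒟≡B)
    where
    isComplete : IsComplete G
    isComplete = ≅K⇒complete G G≅K
    total≡ : ∑[ v ∈ allFin n ] #𝒟∋ G v ≡ n * 2 ^ k
    total≡ = trans (∑-cong (allFin n) (λ v → universal⇒#𝒟∋≡half G v (isComplete v))) (∑-allFin-const n (2 ^ k))
    #𝒟≡B : #𝒟 G ≡ 2 ^ n ∸ 1
    #𝒟≡B = suc-injective (trans (#𝒟-complete G isComplete) (sym B+1≡2m))
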